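{- Let $n\equiv 7,13,15,21 \pmod{24}$ and $u\ge 0$. If there exists a $3$-sun system of order $n+u$ into which a Steiner triple system of order $n$ is embedded, then $u\geq \frac{n-1}{2}+2$.
   Context: All graphs are simple and finite. For a graph $G$, a $G$-design of order $n$ is a pair $(X,\mathcal{B})$ where $|X|=n$ and $\mathcal{B}$ is a collection of subgraphs of the complete graph on $X$ (blocks), each isomorphic to $G$, whose edge sets partition the edges of that complete graph. A Steiner triple system of order $n$ is a $K_3$-design of order $n$. A $3$-sun is the graph on six vertices consisting of a triangle $\{a,b,c\}$ with three pendant edges $\{a,d\},\{b,e\},\{c,f\}$; a $3$-sun system of order $m$ is a $3$-sun-design of order $m$ (these exist iff $m\equiv 0,1,4,9\pmod{12}$). An STS $(X,\mathcal{T})$ is embedded into a $3$-sun system $(X\cup U,\mathcal{S})$ (with $X\cap U=\emptyset$, $|U|=u$) if there is an injective map $f:\mathcal{T}\to\mathcal{S}$ with $T$ a subgraph of $f(T)$ for all $T\in\mathcal{T}$. -}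

module Defs where

open import Data.Nat using (ℕ; _+_; _<_)
open import Data.Fin using (Fin; toℕ)
open import Data.Product using (_×_; Σ; ∃; ∃-syntax; _,_)
open import Data.Sum using (_⊎_)
open import Relation.Binary.PropositionalEquality using (_≡_; _≢_)
open import Function.Definitions using (Injective)

record Triangle (V : Set) : Set where
  constructor tri
  field
    a b c : V
    a≢b : a ≢ b
    a≢c : a ≢ c
    b≢c : b ≢ c

-- A 3-sun: triangle {a,b,c} with pendant edges {a,d},{b,e},{c,f};
-- all six vertices pairwise distinct.
record Sun (V : Set) : Set where
  constructor sun
  field
    a b c d e f : V
    distinct : a ≢ b × a ≢ c × a ≢ d × a ≢ e × a ≢ f
             × b ≢ c × b ≢ d × b ≢ e × b ≢ f
             × c ≢ d × c ≢ e × c ≢ f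
             × d ≢ e × d ≢ f
             × e ≢ f

SameEdge : {V : Set} → V → V → V → V → Set
SameEdge x y p q = (x ≡ p × y ≡ q) ⊎ (x ≡ q × y ≡ p)

EdgeOfTri : {V : Set} → Triangle V → V → V → Set
EdgeOfTri t x y = SameEdge x y a b ⊎ SameEdge x y a c ⊎ SameEdge x y b c
  where open Triangle t

EdgeOfSun : {V : Set} → Sun V → V → V → Set
EdgeOfSun s x y =
  SameEdge x y a b ⊎ SameEdge x y b c ⊎ SameEdge x y a c
  ⊎ SameEdge x y a d ⊎ SameEdge x y b e ⊎ SameEdge x y c f
  where open Sun s

-- H is a subgraph of G (as edge sets; vertices of a triangle are covered by its edges)
TriSubSun : {V : Set} → Triangle V → Sun V → Set
TriSubSun t s = ∀ x y → EdgeOfTri t x y → EdgeOfSun s x y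

-- Vertex set of the big system: Fin (n + u); the STS lives on X = {v | toℕ v < n}.
InX : {m : ℕ} → ℕ → Fin m → Set
InX n v = toℕ v < n

-- Steiner triple system on X ⊆ Fin (n+u): an indexed family of t triples
-- with vertices in X whose edges partition the edges of the complete graph on X:
-- every pair of distinct vertices of X lies in exactly one block.
-- (Blocks are indexed by Fin t; distinct indices are distinct blocks.)
record STSOn (n u : ℕ) : Set where
  field
    t : ℕ
    block : Fin t → Triangle (Fin (n + u))
    inX : ∀ i → InX n (Triangle.a (block i)) × InX n (Triangle.b (block i))
                × InX n (Triangle.c (block i))
    cover : ∀ x y → InX n x → InX n y → x ≢ y → ∃[ i ] EdgeOfTri (block i) x y
    unique : ∀ x y i j → EdgeOfTri (block i) x y → EdgeOfTri (block j) x y → i ≡ j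

record SunSystem (m : ℕ) : Set where
  field
    s : ℕ
    block : Fin s → Sun (Fin m)
    cover : ∀ x y → x ≢ y → ∃[ i ] EdgeOfSun (block i) x y
    unique : ∀ x y i j → EdgeOfSun (block i) x y → EdgeOfSun (block j) x y → i ≡ j

Embedded : {n u : ℕ} → STSOn n u → SunSystem (n + u) → Set
Embedded T S = Σ (Fin (STSOn.t T) → Fin (SunSystem.s S)) λ f →
  Injective _≡_ _≡_ f × (∀ i → TriSubSun (STSOn.block T i) (SunSystem.block S (f i)))

module Submission where

-- Every vertex x of a triangle of the embedded STS is a triangle vertex of the host 3-sun, and its
-- pendant neighbour there lies in U: were it in X, the STS triangle through the pendant edge would
-- have the same host, making the pendant a triangle vertex too.  Fixing x ∈ X, the n − 1 other
-- points y of X are therefore coded injectively by the pendant of x in the sun through {x, y}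
-- (which determines that sun) and the position of y in its triangle relative to x, so n − 1 ≤ 2u.
-- Counting the 12 ordered edges of every sun gives 12 ∣ (n + u)(n + u − 1).  For
-- n ≡ 7, 13, 15, 21 (mod 24) the two smallest values u = (n − 1)/2 and (n + 1)/2 left by the
-- first bound violate the second.

open import Defs
open import Data.Nat using (ℕ; _+_; _*_; _≤_; _%_)
open import Data.Sum using (_⊎_)
open import Data.Product using (Σ)
open import Relation.Binary.PropositionalEquality using (_≡_)

open import Data.Empty using (⊥-elim)
open import Data.Fin using (Fin; zero; suc; toℕ; _↑ˡ_; _↑ʳ_; punchIn; punchOut; reduce≥; _≟_; #_)
open import Data.Fin.Properties
  using (↑ˡ-injective; toℕ-↑ˡ; toℕ<n; suc-injective; punchIn-injective; punchInᵢ≢i; punchOut-injective;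
         splitAt-≥; splitAt⁻¹-↑ʳ; injective⇒≤; *↔×; all?; any?)
open import Data.Nat using (suc; _∸_; _<_; z≤n; _≤?_; NonZero)
open import Data.Nat.Properties
  using (+-comm; *-comm; *-assoc; *-distribˡ-+; ≤-antisym; ≤-trans; ≤-reflexive; *-cancelˡ-≤; *-monoʳ-≤;
         m≤n⇒m<n∨m≡n; ≮⇒≥)
open import Data.Nat.DivMod using (m≡m%n+[m/n]*n; [m+kn]%n≡m%n; %-distribˡ-+; %-distribˡ-*; _/_)
open import Data.Nat.Divisibility using (_∣_; divides; n∣m⇒m%n≡0)
open import Data.Product using (_×_; _,_; proj₁; proj₂; ∃-syntax; ∃₂; swap; map; map₂)
open import Data.Product.Properties using (≡-dec)
import Data.Sum as Sum
open import Data.Sum using (inj₁; inj₂)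
open import Data.Vec using (Vec; []; _∷_; lookup)
open import Data.Vec.Relation.Unary.All using ([]; _∷_)
open import Data.Vec.Relation.Unary.AllPairs using ([]; _∷_)
open import Data.Vec.Relation.Unary.Unique.Propositional using (Unique)
open import Data.Vec.Relation.Unary.Unique.Propositional.Properties using (lookup-injective)
open import Function using (_∘_; _↣_; mk↣; Injection)
open import Function.Definitions using (Injective)
open import Function.Construct.Composition using (_↣-∘_)
open import Function.Properties.Inverse using (↔⇒↣; ↔-sym)
open import Relation.Binary.Definitions using (DecidableEquality)
open import Relation.Binary.PropositionalEquality
  using (_≢_; refl; sym; trans; cong; cong₂; subst; subst₂; module ≡-Reasoning)
open import Relation.Nullary using (Dec; yes; no; ¬_; ¬?)
open import Relation.Nullary.Decidable using (_×-dec_; _⊎-dec_; _→-dec_; from-yes)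

private variable
  A B V : Set
  x y z p q : A

sameEdge-sym : SameEdge x y p q → SameEdge y x p q
sameEdge-sym = Sum.[ inj₂ ∘ swap , inj₁ ∘ swap ]

sameEdge-map : (g : A → B) → SameEdge x y p q → SameEdge (g x) (g y) (g p) (g q)
sameEdge-map g = Sum.map (map (cong g) (cong g)) (map (cong g) (cong g))

sameEdge? : DecidableEquality A → (x y p q : A) → Dec (SameEdge x y p q)
sameEdge? _≟_ x y p q = ((x ≟ p) ×-dec (y ≟ q)) ⊎-dec ((x ≟ q) ×-dec (y ≟ p))

edgeOfTri-sym : (t : Triangle V) → EdgeOfTri t x y → EdgeOfTri t y x
edgeOfTri-sym t = Sum.map sameEdge-sym (Sum.map sameEdge-sym sameEdge-sym)

edgeOfTri-other : (t : Triangle V) → EdgeOfTri t x y → ∃[ z ] EdgeOfTri t x z × y ≢ z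
edgeOfTri-other (tri a b c a≢b a≢c b≢c) = λ where
  (inj₁ (inj₁ (refl , refl)))        → c , inj₂ (inj₁ (inj₁ (refl , refl))) , b≢c
  (inj₁ (inj₂ (refl , refl)))        → c , inj₂ (inj₂ (inj₁ (refl , refl))) , a≢c
  (inj₂ (inj₁ (inj₁ (refl , refl)))) → b , inj₁ (inj₁ (refl , refl)) , b≢c ∘ sym
  (inj₂ (inj₁ (inj₂ (refl , refl)))) → b , inj₂ (inj₂ (inj₂ (refl , refl))) , a≢b
  (inj₂ (inj₂ (inj₁ (refl , refl)))) → a , inj₁ (inj₂ (refl , refl)) , a≢c ∘ sym
  (inj₂ (inj₂ (inj₂ (refl , refl)))) → a , inj₂ (inj₁ (inj₂ (refl , refl))) , a≢b ∘ sym

vertices : Sun V → Vec V 6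
vertices s = a ∷ b ∷ c ∷ d ∷ e ∷ f ∷ []
  where open Sun s

vertex : Sun V → Fin 6 → V
vertex s = lookup (vertices s)

vertices-unique : (s : Sun V) → Unique (vertices s)
vertices-unique (sun _ _ _ _ _ _
    (a≢b , a≢c , a≢d , a≢e , a≢f , b≢c , b≢d , b≢e , b≢f , c≢d , c≢e , c≢f , d≢e , d≢f , e≢f)) =
  (a≢b ∷ a≢c ∷ a≢d ∷ a≢e ∷ a≢f ∷ []) ∷ (b≢c ∷ b≢d ∷ b≢e ∷ b≢f ∷ []) ∷ (c≢d ∷ c≢e ∷ c≢f ∷ []) ∷
  (d≢e ∷ d≢f ∷ []) ∷ (e≢f ∷ []) ∷ [] ∷ []

vertex-injective : (s : Sun V) → Injective _≡_ _≡_ (vertex s)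
vertex-injective s = lookup-injective (vertices-unique s) _ _

-- Facts about the shape of a 3-sun are decided once on this copy on Fin 6 and transported to an
-- arbitrary sun s along the injective map vertex s.
standardSun : Sun (Fin 6)
standardSun = sun (# 0) (# 1) (# 2) (# 3) (# 4) (# 5)
  ((λ ()) , (λ ()) , (λ ()) , (λ ()) , (λ ()) , (λ ()) , (λ ()) , (λ ()) ,
   (λ ()) , (λ ()) , (λ ()) , (λ ()) , (λ ()) , (λ ()) , (λ ()))

StandardEdge : Fin 6 → Fin 6 → Set
StandardEdge = EdgeOfSun standardSun

standardEdge? : (i j : Fin 6) → Dec (StandardEdge i j)
standardEdge? i j = edge (# 0) (# 1) ⊎-dec edge (# 1) (# 2) ⊎-dec edge (# 0) (# 2)
                ⊎-dec edge (# 0) (# 3) ⊎-dec edge (# 1) (# 4) ⊎-dec edge (# 2) (# 5)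
  where edge = sameEdge? _≟_ i j

edgeOfSun-image : (s : Sun V) {i j : Fin 6} → StandardEdge i j → EdgeOfSun s (vertex s i) (vertex s j)
edgeOfSun-image s = Sum.map g (Sum.map g (Sum.map g (Sum.map g (Sum.map g g))))
  where
  g : ∀ {i j p q} → SameEdge i j p q → SameEdge (vertex s i) (vertex s j) (vertex s p) (vertex s q)
  g = sameEdge-map (vertex s)

sameEdge-preimage : (g : A → B) (p q : A) → SameEdge x y (g p) (g q) →
                    ∃₂ λ i j → SameEdge i j p q × x ≡ g i × y ≡ g j
sameEdge-preimage g p q (inj₁ (x≡ , y≡)) = p , q , inj₁ (refl , refl) , x≡ , y≡
sameEdge-preimage g p q (inj₂ (x≡ , y≡)) = q , p , inj₂ (refl , refl) , x≡ , y≡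

StandardPreimage : Sun V → V → V → Set
StandardPreimage s x y = ∃₂ λ i j → StandardEdge i j × x ≡ vertex s i × y ≡ vertex s j

sameEdge-standardPreimage : (s : Sun V) (p q : Fin 6) → (∀ {i j} → SameEdge i j p q → StandardEdge i j) →
                            SameEdge x y (vertex s p) (vertex s q) → StandardPreimage s x y
sameEdge-standardPreimage s p q into e with sameEdge-preimage (vertex s) p q e
... | i , j , e′ , x≡ , y≡ = i , j , into e′ , x≡ , y≡

edgeOfSun-preimage : (s : Sun V) → EdgeOfSun s x y → StandardPreimage s x y
edgeOfSun-preimage s (inj₁ e) =
  sameEdge-standardPreimage s (# 0) (# 1) inj₁ e
edgeOfSun-preimage s (inj₂ (inj₁ e)) =
  sameEdge-standardPreimage s (# 1) (# 2) (inj₂ ∘ inj₁) e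
edgeOfSun-preimage s (inj₂ (inj₂ (inj₁ e))) =
  sameEdge-standardPreimage s (# 0) (# 2) (inj₂ ∘ inj₂ ∘ inj₁) e
edgeOfSun-preimage s (inj₂ (inj₂ (inj₂ (inj₁ e)))) =
  sameEdge-standardPreimage s (# 0) (# 3) (inj₂ ∘ inj₂ ∘ inj₂ ∘ inj₁) e
edgeOfSun-preimage s (inj₂ (inj₂ (inj₂ (inj₂ (inj₁ e))))) =
  sameEdge-standardPreimage s (# 1) (# 4) (inj₂ ∘ inj₂ ∘ inj₂ ∘ inj₂ ∘ inj₁) e
edgeOfSun-preimage s (inj₂ (inj₂ (inj₂ (inj₂ (inj₂ e))))) =
  sameEdge-standardPreimage s (# 2) (# 5) (inj₂ ∘ inj₂ ∘ inj₂ ∘ inj₂ ∘ inj₂) e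

triangle pendant : Fin 3 → Fin 6
triangle c = c ↑ˡ 3
pendant c = 3 ↑ʳ c

standardEdge-irreflexive : ∀ i → ¬ StandardEdge i i
standardEdge-irreflexive = from-yes (all? λ i → ¬? (standardEdge? i i))

standardEdge-pendant : ∀ c → StandardEdge (triangle c) (pendant c)
standardEdge-pendant = from-yes (all? λ c → standardEdge? (triangle c) (pendant c))

triangle≢pendant : ∀ c c′ → triangle c ≢ pendant c′
triangle≢pendant = from-yes (all? λ c → all? λ c′ → ¬? (triangle c ≟ pendant c′))

standardEdge-branching : ∀ i j j′ → StandardEdge i j → StandardEdge i j′ → j ≢ j′ → ∃[ c ] i ≡ triangle c
standardEdge-branching = from-yes (all? λ i → all? λ j → all? λ j′ →
  standardEdge? i j →-dec standardEdge? i j′ →-dec ¬? (j ≟ j′) →-dec any? λ c → i ≟ triangle c)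

TriangleVertex : Sun V → V → Set
TriangleVertex s x = ∃[ c ] x ≡ vertex s (triangle c)

edgeOfSun-irreflexive : (s : Sun V) → ¬ EdgeOfSun s x x
edgeOfSun-irreflexive s e with edgeOfSun-preimage s e
... | i , j , e′ , x≡ , x≡′ with vertex-injective s {i} {j} (trans (sym x≡) x≡′)
... | refl = standardEdge-irreflexive i e′

edgeOfSun-pendant : (s : Sun V) (c : Fin 3) → EdgeOfSun s (vertex s (triangle c)) (vertex s (pendant c))
edgeOfSun-pendant s c = edgeOfSun-image s (standardEdge-pendant c)

triangleVertex≢pendantVertex : (s : Sun V) (c c′ : Fin 3) → vertex s (triangle c) ≢ vertex s (pendant c′)
triangleVertex≢pendantVertex s c c′ = triangle≢pendant c c′ ∘ vertex-injective s

edgeOfSun-branching : (s : Sun V) → EdgeOfSun s x y → EdgeOfSun s x z → y ≢ z → TriangleVertex s x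
edgeOfSun-branching s exy exz y≢z with edgeOfSun-preimage s exy | edgeOfSun-preimage s exz
... | i , j , e , x≡ , y≡ | i′ , j′ , e′ , x≡′ , z≡ with vertex-injective s {i} {i′} (trans (sym x≡) x≡′)
... | refl = map₂ (λ i≡ → trans x≡ (cong (vertex s) i≡))
                  (standardEdge-branching i j j′ e e′ (λ { refl → y≢z (trans y≡ (sym z≡)) }))

triSubSun-triangleVertex : (t : Triangle V) (s : Sun V) → TriSubSun t s →
                           ∀ {x y} → EdgeOfTri t x y → TriangleVertex s x
triSubSun-triangleVertex t s t⊆s {x} {y} e with edgeOfTri-other t e
... | z , e′ , y≢z = edgeOfSun-branching s (t⊆s x y e) (t⊆s x z e′) y≢z

arcs : Vec (Fin 6 × Fin 6) 12
arcs = (# 0 , # 1) ∷ (# 1 , # 0) ∷ (# 1 , # 2) ∷ (# 2 , # 1) ∷ (# 0 , # 2) ∷ (# 2 , # 0) ∷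
       (# 0 , # 3) ∷ (# 3 , # 0) ∷ (# 1 , # 4) ∷ (# 4 , # 1) ∷ (# 2 , # 5) ∷ (# 5 , # 2) ∷ []

arc : Fin 12 → Fin 6 × Fin 6
arc = lookup arcs

arc-standardEdge : ∀ k → StandardEdge (proj₁ (arc k)) (proj₂ (arc k))
arc-standardEdge = from-yes (all? λ k → standardEdge? (proj₁ (arc k)) (proj₂ (arc k)))

arc-injective : ∀ k k′ → arc k ≡ arc k′ → k ≡ k′
arc-injective = from-yes (all? λ k → all? λ k′ → ≡-dec _≟_ _≟_ (arc k) (arc k′) →-dec k ≟ k′)

standardEdge-arc : ∀ i j → StandardEdge i j → ∃[ k ] arc k ≡ (i , j)
standardEdge-arc = from-yes (all? λ i → all? λ j →
  standardEdge? i j →-dec any? λ k → ≡-dec _≟_ _≟_ (arc k) (i , j))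

arcEnds : Sun V → Fin 12 → V × V
arcEnds s k = map (vertex s) (vertex s) (arc k)

arcEnds-edge : (s : Sun V) (k : Fin 12) → EdgeOfSun s (proj₁ (arcEnds s k)) (proj₂ (arcEnds s k))
arcEnds-edge s k = edgeOfSun-image s (arc-standardEdge k)

arcEnds-injective : (s : Sun V) {k k′ : Fin 12} → arcEnds s k ≡ arcEnds s k′ → k ≡ k′
arcEnds-injective s {k} {k′} eq = arc-injective k k′
  (cong₂ _,_ (vertex-injective s (cong proj₁ eq)) (vertex-injective s (cong proj₂ eq)))

module _ {m} (S : SunSystem m) where
  open SunSystem S

  position : Fin s × Fin 12 → Fin m × Fin m
  position (i , k) = arcEnds (block i) k

  position-edge : ∀ i k → EdgeOfSun (block i) (proj₁ (position (i , k))) (proj₂ (position (i , k)))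
  position-edge i = arcEnds-edge (block i)

  position-distinct : ∀ p → proj₁ (position p) ≢ proj₂ (position p)
  position-distinct (i , k) eq =
    edgeOfSun-irreflexive (block i) (subst (EdgeOfSun (block i) _) (sym eq) (position-edge i k))

  position-injective : Injective _≡_ _≡_ position
  position-injective {i , k} {i′ , k′} eq
    with unique _ _ i i′ (position-edge i k)
                (subst (λ (x , y) → EdgeOfSun (block i′) x y) (sym eq) (position-edge i′ k′))
  ... | refl = cong (i ,_) (arcEnds-injective (block i) eq)

  position-surjective : ∀ x y → x ≢ y → ∃[ p ] position p ≡ (x , y)
  position-surjective x y x≢y with cover x y x≢y
  ... | i , e with edgeOfSun-preimage (block i) e
  ... | a , b , e′ , x≡ , y≡ with standardEdge-arc a b e′
  ... | k , arc≡ = (i , k) , trans (cong (map (vertex (block i)) (vertex (block i))) arc≡)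
                                   (cong₂ _,_ (sym x≡) (sym y≡))

  pendant-determines-block : ∀ {i i′ c c′} → vertex (block i) (triangle c) ≡ vertex (block i′) (triangle c′) →
                             vertex (block i) (pendant c) ≡ vertex (block i′) (pendant c′) → i ≡ i′
  pendant-determines-block {i} {i′} {c} {c′} x≡ p≡ =
    unique _ _ i i′ (edgeOfSun-pendant (block i) c)
                    (subst₂ (EdgeOfSun (block i′)) (sym x≡) (sym p≡) (edgeOfSun-pendant (block i′) c′))

fin↣fin×fin⇒≤ : ∀ {a b c} → Fin a ↣ (Fin b × Fin c) → a ≤ b * c
fin↣fin×fin⇒≤ f = injective⇒≤ (Injection.injective (↔⇒↣ (↔-sym *↔×) ↣-∘ f))

fin×fin↣fin×fin⇒≤ : ∀ {a b c d} → (Fin a × Fin b) ↣ (Fin c × Fin d) → a * b ≤ c * d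
fin×fin↣fin×fin⇒≤ f = fin↣fin×fin⇒≤ (f ↣-∘ ↔⇒↣ *↔×)

punchInPair : ∀ {m} → Fin (suc m) × Fin m → Fin (suc m) × Fin (suc m)
punchInPair (x , j) = x , punchIn x j

punchInPair-injective : ∀ {m} → Injective _≡_ _≡_ (punchInPair {m})
punchInPair-injective {x = x , _} eq with cong proj₁ eq
... | refl = cong (x ,_) (punchIn-injective x _ _ (cong proj₂ eq))

punchOut-pair-injective : ∀ {m} {x x′ y y′ : Fin (suc m)} {x≢y : x ≢ y} {x′≢y′ : x′ ≢ y′} →
                          (x , punchOut x≢y) ≡ (x′ , punchOut x′≢y′) → (x , y) ≡ (x′ , y′)
punchOut-pair-injective {x = x} {x≢y = x≢y} {x′≢y′} eq with cong proj₁ eq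
... | refl = cong (x ,_) (punchOut-injective x≢y x′≢y′ (cong proj₂ eq))

sunSystem-arcCount : ∀ {m} (S : SunSystem (suc m)) → suc m * m ≡ SunSystem.s S * 12
sunSystem-arcCount {m} S =
  ≤-antisym (fin×fin↣fin×fin⇒≤ pairs↣positions) (fin×fin↣fin×fin⇒≤ positions↣pairs)
  where
  locate : ∀ p → ∃[ q ] position S q ≡ punchInPair p
  locate (x , j) = position-surjective S x (punchIn x j) (punchInᵢ≢i x j ∘ sym)

  pairs↣positions : (Fin (suc m) × Fin m) ↣ (Fin (SunSystem.s S) × Fin 12)
  pairs↣positions = mk↣ {to = proj₁ ∘ locate} λ {p} {p′} eq →
    punchInPair-injective
      (trans (sym (proj₂ (locate p))) (trans (cong (position S) eq) (proj₂ (locate p′))))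

  positions↣pairs : (Fin (SunSystem.s S) × Fin 12) ↣ (Fin (suc m) × Fin m)
  positions↣pairs = mk↣ {to = λ p → proj₁ (position S p) , punchOut (position-distinct S p)}
    (position-injective S ∘ punchOut-pair-injective)

sunSystem-order : ∀ {m} → SunSystem m → 12 ∣ m * (m ∸ 1)
sunSystem-order {0}     S = divides 0 refl
sunSystem-order {suc m} S = divides (SunSystem.s S) (sunSystem-arcCount S)

reduce≥-injective : ∀ {m n} (i j : Fin (m + n)) .(i≥m : m ≤ toℕ i) .(j≥m : m ≤ toℕ j) →
                    reduce≥ i i≥m ≡ reduce≥ j j≥m → i ≡ j
reduce≥-injective {m} i j i≥m j≥m eq =
  trans (sym (splitAt⁻¹-↑ʳ (splitAt-≥ m i i≥m)))
        (trans (cong (m ↑ʳ_) eq) (splitAt⁻¹-↑ʳ (splitAt-≥ m j j≥m)))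

inX-↑ˡ : ∀ {n} u (i : Fin n) → InX n (i ↑ˡ u)
inX-↑ˡ u i = subst (_< _) (sym (toℕ-↑ˡ i u)) (toℕ<n i)

module _ {n u} (T : STSOn n u) (S : SunSystem (n + u)) (E : Embedded T S) where
  open STSOn T renaming (block to triangleBlock; cover to triangle-cover)
  open SunSystem S renaming (block to sunBlock; unique to sun-unique)

  host : Fin t → Sun (Fin (n + u))
  host i = sunBlock (proj₁ E i)

  host-triangleVertex : ∀ {i x y} → EdgeOfTri (triangleBlock i) x y → TriangleVertex (host i) x
  host-triangleVertex {i} = triSubSun-triangleVertex (triangleBlock i) (host i) (proj₂ (proj₂ E) i)

  host-pendant∉X : ∀ {x i c} → InX n x → x ≡ vertex (host i) (triangle c) →
                   ¬ InX n (vertex (host i) (pendant c))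
  host-pendant∉X {x} {i} {c} x∈X x≡ p∈X
    with triangle-cover x _ x∈X p∈X (triangleVertex≢pendantVertex (host i) c c ∘ trans (sym x≡))
  ... | i′ , e with proj₁ (proj₂ E) {i′} {i} (sun-unique _ _ _ _ (proj₂ (proj₂ E) i′ _ _ e) xp∈host)
    where xp∈host = subst (λ v → EdgeOfSun (host i) v _) (sym x≡) (edgeOfSun-pendant (host i) c)
  ... | refl with host-triangleVertex (edgeOfTri-sym (triangleBlock i) e)
  ... | c′ , p≡ = triangleVertex≢pendantVertex (host i) c′ c (sym p≡)

  record SunThrough (x y : Fin (n + u)) : Set where
    constructor through
    field
      index : Fin s
      cx cy : Fin 3
      cx≢cy : cx ≢ cy
      x≡ : x ≡ vertex (sunBlock index) (triangle cx)
      y≡ : y ≡ vertex (sunBlock index) (triangle cy)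
      pendant∉X : ¬ InX n (vertex (sunBlock index) (pendant cx))

  sunThrough : ∀ {x y} → InX n x → InX n y → x ≢ y → SunThrough x y
  sunThrough {x} {y} x∈X y∈X x≢y with triangle-cover x y x∈X y∈X x≢y
  ... | i , e with host-triangleVertex e | host-triangleVertex (edgeOfTri-sym (triangleBlock i) e)
  ... | cx , x≡ | cy , y≡ =
    through (proj₁ E i) cx cy (λ { refl → x≢y (trans x≡ (sym y≡)) }) x≡ y≡
            (host-pendant∉X {i = i} {cx} x∈X x≡)

  code : ∀ {x y} → SunThrough x y → Fin u × Fin 2
  code (through i cx _ cx≢cy _ _ p∉X) =
    reduce≥ (vertex (sunBlock i) (pendant cx)) (≮⇒≥ p∉X) , punchOut cx≢cy

  code-injective : ∀ {x y y′} (σ : SunThrough x y) (σ′ : SunThrough x y′) → code σ ≡ code σ′ → y ≡ y′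
  code-injective (through i cx cy cx≢cy x≡ y≡ _) (through i′ cx′ cy′ cx′≢cy′ x≡′ y≡′ _) eq
    with pendant-determines-block S {i} {i′} {cx} {cx′} (trans (sym x≡) x≡′)
                                   (reduce≥-injective _ _ _ _ (cong proj₁ eq))
  ... | refl with ↑ˡ-injective 3 cx cx′ (vertex-injective (sunBlock i) {triangle cx} {triangle cx′}
                                                           (trans (sym x≡) x≡′))
  ... | refl = trans y≡ (trans (cong (vertex (sunBlock i) ∘ triangle) cy≡cy′) (sym y≡′))
    where cy≡cy′ = punchOut-injective cx≢cy cx′≢cy′ (cong proj₂ eq)

embedding-bound : ∀ {n u} (T : STSOn n u) (S : SunSystem (n + u)) → Embedded T S → n ∸ 1 ≤ 2 * u
embedding-bound {0}     _ _ _ = z≤n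
embedding-bound {suc n} {u} T S E = ≤-trans (fin↣fin×fin⇒≤ others↣codes) (≤-reflexive (*-comm u 2))
  where
  sunThroughZero : (j : Fin n) → SunThrough T S E zero (suc j ↑ˡ u)
  sunThroughZero j = sunThrough T S E (inX-↑ˡ u zero) (inX-↑ˡ u (suc j)) (λ ())

  others↣codes : Fin n ↣ (Fin u × Fin 2)
  others↣codes = mk↣ {to = code T S E ∘ sunThroughZero} λ eq →
    suc-injective (↑ˡ-injective u _ _ (code-injective T S E (sunThroughZero _) (sunThroughZero _) eq))

%-cong-+ : ∀ a a′ b b′ d .{{_ : NonZero d}} → a % d ≡ a′ % d → b % d ≡ b′ % d →
           (a + b) % d ≡ (a′ + b′) % d
%-cong-+ a a′ b b′ d a≡ b≡ = begin
  (a + b) % d           ≡⟨ %-distribˡ-+ a b d ⟩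
  (a % d + b % d) % d   ≡⟨ cong₂ (λ a b → (a + b) % d) a≡ b≡ ⟩
  (a′ % d + b′ % d) % d ≡⟨ %-distribˡ-+ a′ b′ d ⟨
  (a′ + b′) % d         ∎
  where open ≡-Reasoning

%-cong-* : ∀ a a′ b b′ d .{{_ : NonZero d}} → a % d ≡ a′ % d → b % d ≡ b′ % d →
           (a * b) % d ≡ (a′ * b′) % d
%-cong-* a a′ b b′ d a≡ b≡ = begin
  (a * b) % d             ≡⟨ %-distribˡ-* a b d ⟩
  (a % d * (b % d)) % d   ≡⟨ cong₂ (λ a b → (a * b) % d) a≡ b≡ ⟩
  (a′ % d * (b′ % d)) % d ≡⟨ %-distribˡ-* a′ b′ d ⟨
  (a′ * b′) % d           ∎
  where open ≡-Reasoning

¬∣-%-cong : ∀ a b d .{{_ : NonZero d}} → a % d ≡ b % d → b % d ≢ 0 → ¬ d ∣ a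
¬∣-%-cong a b d a≡b b≢0 d∣a = b≢0 (trans (sym a≡b) (n∣m⇒m%n≡0 a d d∣a))

pronic : ℕ → ℕ
pronic x = suc x * x

pronic-%-cong : ∀ x y d .{{_ : NonZero d}} → x % d ≡ y % d → pronic x % d ≡ pronic y % d
pronic-%-cong x y d x≡y = %-cong-* (suc x) (suc y) x y d (%-cong-+ 1 1 x y d refl x≡y) x≡y

odd-residue : ∀ n r → n % 24 ≡ suc (2 * r) → ∃[ k ] n ≡ suc (2 * k) × k % 12 ≡ r % 12
odd-residue n r n%24 = r + n / 24 * 12 , n≡ , [m+kn]%n≡m%n r (n / 24) 12
  where
  regroup : ∀ q → suc (2 * r) + q * 24 ≡ suc (2 * (r + q * 12))
  regroup q = cong suc (trans (cong (2 * r +_) (trans (sym (*-assoc q 12 2)) (*-comm (q * 12) 2)))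
                              (sym (*-distribˡ-+ 2 r (q * 12))))

  n≡ : n ≡ suc (2 * (r + n / 24 * 12))
  n≡ = trans (m≡m%n+[m/n]*n n 24) (trans (cong (_+ n / 24 * 24) n%24) (regroup (n / 24)))

half-between : ∀ k u → 2 * k ≤ 2 * u → ¬ (suc (2 * k) + 3 ≤ 2 * u) → u ≡ k ⊎ u ≡ suc k
half-between k u 2k≤2u n+3≰2u with m≤n⇒m<n∨m≡n (*-cancelˡ-≤ 2 2k≤2u)
... | inj₂ k≡u = inj₁ (sym k≡u)
... | inj₁ k<u with m≤n⇒m<n∨m≡n k<u
...   | inj₂ k+1≡u = inj₂ (sym k+1≡u)
...   | inj₁ k+2≤u = ⊥-elim (n+3≰2u (≤-trans (≤-reflexive double) (*-monoʳ-≤ 2 k+2≤u)))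
  where
  double : suc (2 * k) + 3 ≡ 2 * suc (suc k)
  double = trans (cong suc (+-comm (2 * k) 3)) (sym (*-distribˡ-+ 2 2 k))

order-excluded : ∀ k r v w → k % 12 ≡ r % 12 → v % 12 ≡ w % 12 →
                 pronic (2 * r + w) % 12 ≢ 0 → ¬ 12 ∣ pronic (2 * k + v)
order-excluded k r v w k≡r v≡w =
  ¬∣-%-cong (pronic (2 * k + v)) (pronic (2 * r + w)) 12
    (pronic-%-cong (2 * k + v) (2 * r + w) 12
      (%-cong-+ (2 * k) (2 * r) v w 12 (%-cong-* 2 2 k r 12 refl k≡r) v≡w))

-- Writing n = 2k + 1 with k ≡ r (mod 12), the bounds n − 1 ≤ 2u < n + 3 leave u = k or k + 1,
-- and then (n + u) * (n + u ∸ 1) reduces to pronic (2 * k + u).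
ExcludedResidue : ℕ → Set
ExcludedResidue r = pronic (2 * r + r) % 12 ≢ 0 × pronic (2 * r + suc r) % 12 ≢ 0

counting⇒n+3≤2u : ∀ n u r → ExcludedResidue r → n % 24 ≡ suc (2 * r) →
                  n ∸ 1 ≤ 2 * u → 12 ∣ (n + u) * (n + u ∸ 1) → n + 3 ≤ 2 * u
counting⇒n+3≤2u n u r (gap₀ , gap₁) n%24 n-1≤2u 12∣m[m-1] with odd-residue n r n%24
... | k , refl , k≡r with suc (2 * k) + 3 ≤? 2 * u
... | yes n+3≤2u = n+3≤2u
... | no n+3≰2u with half-between k u n-1≤2u n+3≰2u
...   | inj₁ refl = ⊥-elim (order-excluded k r k r k≡r k≡r gap₀ 12∣m[m-1])
...   | inj₂ refl =
  ⊥-elim (order-excluded k r (suc k) (suc r) k≡r (%-cong-+ 1 1 k r 12 refl k≡r) gap₁ 12∣m[m-1])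

lemma2p4 : (n u : ℕ)
    → (n % 24 ≡ 7) ⊎ (n % 24 ≡ 13) ⊎ (n % 24 ≡ 15) ⊎ (n % 24 ≡ 21)
    → Σ (STSOn n u) (λ T → Σ (SunSystem (n + u)) (λ S → Embedded T S))
    → (n + 3) ≤ 2 * u
lemma2p4 n u residue (T , S , E) =
  Sum.[ bound 3 ((λ ()) , (λ ())) ,
  Sum.[ bound 6 ((λ ()) , (λ ())) ,
  Sum.[ bound 7 ((λ ()) , (λ ())) ,
        bound 10 ((λ ()) , (λ ())) ] ] ] residue
  where
  bound : ∀ r → ExcludedResidue r → n % 24 ≡ suc (2 * r) → n + 3 ≤ 2 * u
  bound r excluded n%24 =
    counting⇒n+3≤2u n u r excluded n%24 (embedding-bound T S E) (sunSystem-order S)
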